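{- Let $\mathcal{G}=(V,E)$ be a graph with chromatic number $3$, and let $V=V_1\cup V_2\cup V_3$ be a partition into color classes of a proper $3$-coloring. For $i\in\{1,2,3\}$ let $2\rho_i-1$ be the odd girth of the contracted graph $\mathcal{G}/V_i$. Then \[\chi^f(\mathcal{G})\le 2+\min_{i\in\{1,2,3\}}\frac{1}{\rho_i-1}.\] Moreover, equality holds if one color class contains only one vertex.
   Context: $\mathcal{G}/V_i$ is the multigraph obtained by contracting all vertices of $V_i$ into a single new vertex (parallel edges kept, no self-loops). The odd girth is the length of a shortest odd cycle. With $\mathcal{I}$ the set of independent sets of $\mathcal{G}$, the fractional chromatic number $\chi^f(\mathcal{G})$ is the optimal value of $\min\sum_{I\in\mathcal{I}}y_I$ subject to $\sum_{I\in\mathcal{I}: v\in I}y_I\ge1$ for all $v\in V$ and $y_I\ge0$ for all $I\in\mathcal{I}$. -}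

module Defs where

open import Data.Nat as ℕ using (ℕ; zero; suc)
open import Data.Fin using (Fin; zero; suc) renaming (_+_ to _+F_)
open import Data.Fin as F using ()
open import Data.Bool using (Bool; true; false; if_then_else_; _∧_)
open import Data.Vec using (Vec; []; _∷_; lookup)
open import Data.Maybe using (Maybe; just; nothing)
open import Data.Product using (Σ; ∃; _×_; _,_)
open import Data.Integer using (+_)
open import Data.Rational using (ℚ; 0ℚ; _+_; _≤_; _/_)
open import Data.Fin.Subset using (Subset)
open import Function.Definitions using (Injective)
open import Relation.Binary.PropositionalEquality using (_≡_; _≢_)
open import Relation.Nullary using (¬_)

record Graph (n : ℕ) : Set where
  field
    adj   : Fin n → Fin n → Bool
    sym   : ∀ u v → adj u v ≡ adj v u
    irrfl : ∀ v → adj v v ≡ false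
open Graph public

Adj : ∀ {n} → Graph n → Fin n → Fin n → Set
Adj G u v = adj G u v ≡ true

ProperColoring : ∀ {n} → Graph n → (k : ℕ) → (Fin n → Fin k) → Set
ProperColoring G k c = ∀ u v → Adj G u v → c u ≢ c v

Colorable : ∀ {n} → Graph n → ℕ → Set
Colorable {n} G k = Σ (Fin n → Fin k) (ProperColoring G k)

ChromaticNumber : ∀ {n} → Graph n → ℕ → Set
ChromaticNumber G k = Colorable G k × (∀ j → j ℕ.< k → ¬ Colorable G j)

next : ∀ {k} → Fin (suc k) → Fin (suc k)
next {k} i = F.fromℕ< {(ℕ._%_ (suc (F.toℕ i)) (suc k))} (Data.Nat.DivMod.m%n<n (suc (F.toℕ i)) (suc k))
  where import Data.Nat.DivMod

OddCycleOfLength : {A : Set} → (A → A → Set) → ℕ → Set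
OddCycleOfLength {A} R k =
  Σ ℕ λ m → (k ≡ suc (suc (suc (m ℕ.* 2)))) ×
  Σ (Fin k → A) λ f → Injective _≡_ _≡_ f × 
    (∀ (i : Fin k) → R (f i) (f (nextOf i)))
  where
    nextOf : ∀ {k'} → Fin k' → Fin k'
    nextOf {suc k'} i = next i

IsOddGirth : {A : Set} → (A → A → Set) → ℕ → Set
IsOddGirth R g = OddCycleOfLength R g × (∀ k → OddCycleOfLength R k → g ℕ.≤ k)

-- Contraction G / V_i where V_i = c⁻¹(i): vertex set Maybe (Fin n), 'nothing' is the
-- new contracted vertex, 'just v' (v ∉ V_i) the other vertices (vertices 'just w'
-- with w ∈ V_i are unused and isolated).  Two distinct vertices are adjacent iff
-- at least one edge of G joins their preimages (edge multiplicity is irrelevant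
-- for cycles of length ≥ 3, and loops are discarded).
contractMap : ∀ {n k} → (Fin n → Fin k) → Fin k → Fin n → Maybe (Fin n)
contractMap c i v with c v F.≟ i
... | Relation.Nullary.yes _ = nothing
... | Relation.Nullary.no _ = just v

ContractAdj : ∀ {n k} → Graph n → (Fin n → Fin k) → Fin k → Maybe (Fin n) → Maybe (Fin n) → Set
ContractAdj G c i a b =
  a ≢ b × Σ _ λ u → Σ _ λ v → contractMap c i u ≡ a × contractMap c i v ≡ b × Adj G u v

independent : ∀ {n} → Graph n → Subset n → Bool
independent {n} G I = allPairs (Data.Vec.allFin n)
  where
    open import Data.Vec using (foldr)
    allPairs : ∀ {m} → Vec (Fin n) m → Bool
    allPairs vs = foldr _ (λ u acc → foldr _ (λ v acc' →
       Data.Bool.not (lookup I u ∧ lookup I v ∧ adj G u v) ∧ acc') acc vs) true vs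

sumSubsets : ∀ {n} → (Subset n → ℚ) → ℚ
sumSubsets {zero} f = f []
sumSubsets {suc n} f = sumSubsets (λ s → f (false ∷ s)) + sumSubsets (λ s → f (true ∷ s))

sumIndep : ∀ {n} → Graph n → (Subset n → Bool) → (Subset n → ℚ) → ℚ
sumIndep G P y = sumSubsets (λ I → if independent G I ∧ P I then y I else 0ℚ)

-- Feasible solutions of the fractional colouring LP (weights indexed by subsets;
-- only those on independent sets are used / constrained).
Feasible : ∀ {n} → Graph n → (Subset n → ℚ) → Set
Feasible G y =
  (∀ I → independent G I ≡ true → 0ℚ ≤ y I) ×
  (∀ v → (+ 1 / 1) ≤ sumIndep G (λ I → lookup I v) y)

objective : ∀ {n} → Graph n → (Subset n → ℚ) → ℚ
objective G y = sumIndep G (λ _ → true) y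

IsFractionalChromaticNumber : ∀ {n} → Graph n → ℚ → Set
IsFractionalChromaticNumber G r =
  (Σ _ λ y → Feasible G y × objective G y ≡ r) ×
  (∀ y → Feasible G y → r ≤ objective G y)

-- 1 / (ρ - 1) for ρ ≥ 2; (junk value 0 for ρ < 2, which cannot occur here
-- since the odd girth of a contraction is ≥ 3, i.e. ρ ≥ 2).
invPred : ℕ → ℚ
invPred (suc (suc k)) = + 1 / suc k
invPred _ = 0ℚ

module Submission where

-- Fix a colour class V_i and put k = ρ_i − 1, so that G/V_i has odd girth 2k+1. Layer the
-- vertices by their distance from V_i, truncated at k. An edge inside a layer d < k would close,
-- with two geodesics back to V_i, an odd cycle of length 2d+1 in G/V_i; so edges inside a layer
-- only occur in the top layer. Using that only two colours remain outside V_i, the layering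
-- becomes a homomorphism from G to the cycle C_{2k+1}, and the 2k+1 independent sets
-- {j+2, j+4, …, j+2k} of C_{2k+1} cover every vertex k times, whence χ_f ≤ (2k+1)/k.
-- If V_i = {v}, an odd cycle of length 2k+1 in G/V_i is a closed walk in G. An independent set
-- meets it in at most k positions, so summing the covering constraints along it gives
-- k·χ_f ≥ 2k+1.

open import Defs hiding (sym)
open import Data.Nat as ℕ using (ℕ; zero; suc; _*_; _∸_; z≤n; s≤s)
import Data.Nat.Properties as ℕP
open import Data.Integer as ℤ using (+_)
open import Data.Rational using (ℚ; 0ℚ; 1ℚ; _+_; _≤_; _<_; _⊓_; _/_; toℚᵘ)
import Data.Integer.Properties as ℤP
import Data.Rational.Properties as ℚP
open import Data.Rational.Unnormalised as ℚᵘ using (mkℚᵘ; *≡*)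
import Data.Rational.Unnormalised.Properties as ℚᵘP
open import Data.Integer.Tactic.RingSolver using (solve-∀)
open import Function.Definitions using (Injective)
open import Algebra.Properties.CommutativeMonoid.Mult ℚP.+-0-commutativeMonoid
  using (×-homo-+; ×-distrib-+) renaming (_×_ to _·_)
open import Algebra.Properties.CommutativeMonoid.Sum ℚP.+-0-commutativeMonoid
  using (sum; sum-syntax; sum-cong-≗; ∑-distrib-+; sum-replicate; sum-replicate-zero)
import Algebra.Properties.CommutativeMonoid.Sum ℕP.+-0-commutativeMonoid as ℕΣ
open import Data.Fin as Fin using (Fin; zero; suc; toℕ; punchOut)
import Data.Fin.Properties as FinP
open import Data.Fin.Properties using (pigeonhole; punchOut-injective)
open import Data.Vec using (Vec; []; _∷_; lookup; foldr; allFin; tabulate)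
open import Data.Vec.Relation.Unary.Any using (here; there)
open import Data.Vec.Membership.Propositional using (_∈_)
open import Data.Vec.Membership.Propositional.Properties using (∈-allFin⁺)
open import Data.Vec.Functional using (replicate)
open import Data.Fin.Subset using (Subset)
open import Data.Bool using (Bool; true; false; if_then_else_; _∧_; _∨_; not; _xor_)
open import Data.Product using (Σ; _×_; _,_; proj₁; proj₂)
open import Data.Sum as Sum using (_⊎_; inj₁; inj₂)
open import Relation.Binary.PropositionalEquality
open import Relation.Nullary using (Dec; yes; no; does; ¬_)
open import Relation.Nullary.Decidable using (dec-true; dec-false; _⊎-dec_; _×-dec_)
import Data.Bool.Properties as BoolP
open import Data.Empty using (⊥-elim)
open import Data.Maybe using (Maybe; just; nothing)
open import Relation.Binary using (tri<; tri≈; tri>)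
open import Data.Nat.DivMod using (_%_; m≤n⇒m%n≡m; n%n≡0)
open import Function using (_∘_; flip; case_of_)
open import Data.Vec.Properties using (∷-injectiveʳ; lookup∘tabulate) renaming (≡-dec to Vec-≡-dec)

·-monoʳ-≤ : ∀ m {x y} → x ≤ y → m · x ≤ m · y
·-monoʳ-≤ zero    x≤y = ℚP.≤-refl
·-monoʳ-≤ (suc m) x≤y = ℚP.+-mono-≤ x≤y (·-monoʳ-≤ m x≤y)

·-monoʳ-< : ∀ m {x y} → x < y → suc m · x < suc m · y
·-monoʳ-< m x<y = ℚP.+-mono-<-≤ x<y (·-monoʳ-≤ m (ℚP.<⇒≤ x<y))

·-monoˡ-≤ : ∀ {x} → 0ℚ ≤ x → ∀ {m n} → m ℕ.≤ n → m · x ≤ n · x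
·-monoˡ-≤ {x} 0≤x {n = n} z≤n = nonNeg n
  where
  nonNeg : ∀ n → 0ℚ ≤ n · x
  nonNeg zero    = ℚP.≤-refl
  nonNeg (suc n) = ℚP.+-mono-≤ 0≤x (nonNeg n)
·-monoˡ-≤ {x} 0≤x (s≤s m≤n) = ℚP.+-monoʳ-≤ x (·-monoˡ-≤ 0≤x m≤n)

·-unitFraction : ∀ m k → toℚᵘ (m · (+ 1 / suc k)) ℚᵘ.≃ mkℚᵘ (+ m) k
·-unitFraction zero    k = *≡* (ℤP.*-zeroˡ (+ suc k))
·-unitFraction (suc m) k = ℚᵘP.≃-trans (ℚP.toℚᵘ-homo-+ w (m · w))
  (ℚᵘP.≃-trans (ℚᵘP.+-cong (ℚP.toℚᵘ-fromℚᵘ (mkℚᵘ (+ 1) k)) (·-unitFraction m k)) add)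
  where
  w : ℚ
  w = + 1 / suc k
  add : mkℚᵘ (+ 1) k ℚᵘ.+ mkℚᵘ (+ m) k ℚᵘ.≃ mkℚᵘ (+ suc m) k
  add = *≡* (trans (identity (+ m) (+ suc k)) (cong (+ suc m ℤ.*_) (sym (ℤP.pos-* (suc k) (suc k)))))
    where
    identity : ∀ a d → (+ 1 ℤ.* d ℤ.+ a ℤ.* d) ℤ.* d ≡ (+ 1 ℤ.+ a) ℤ.* (d ℤ.* d)
    identity = solve-∀

·-unitFraction-cancel : ∀ k → suc k · (+ 1 / suc k) ≡ 1ℚ
·-unitFraction-cancel k = ℚP.toℚᵘ-injective
  (ℚᵘP.≃-trans (·-unitFraction (suc k) k) (*≡* (ℤP.*-comm (+ suc k) (+ 1))))

·-oddUnitFraction : ∀ k → suc (suc k ℕ.+ suc k) · (+ 1 / suc k) ≡ (+ 2 / 1) + (+ 1 / suc k)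
·-oddUnitFraction k = begin
  w + (K ℕ.+ K) · w   ≡⟨ cong (λ z → w + z) (×-homo-+ w K K) ⟩
  w + (K · w + K · w) ≡⟨ cong (λ z → w + (z + z)) (·-unitFraction-cancel k) ⟩
  w + (+ 2 / 1)        ≡⟨ ℚP.+-comm w (+ 2 / 1) ⟩
  (+ 2 / 1) + w        ∎
  where
  open ≡-Reasoning
  K : ℕ
  K = suc k
  w : ℚ
  w = + 1 / suc k

·-twoPlusUnitFraction : ∀ k → suc k · ((+ 2 / 1) + (+ 1 / suc k)) ≡ suc (suc k ℕ.+ suc k) · 1ℚ
·-twoPlusUnitFraction k = begin
  K · (1ℚ + 1ℚ + w)               ≡⟨ ×-distrib-+ (1ℚ + 1ℚ) w K ⟩
  K · (1ℚ + 1ℚ) + K · w           ≡⟨ cong₂ _+_ (×-distrib-+ 1ℚ 1ℚ K) (·-unitFraction-cancel k) ⟩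
  (K · 1ℚ + K · 1ℚ) + 1ℚ          ≡⟨ cong (_+ 1ℚ) (sym (×-homo-+ 1ℚ K K)) ⟩
  (K ℕ.+ K) · 1ℚ + 1ℚ             ≡⟨ ℚP.+-comm ((K ℕ.+ K) · 1ℚ) 1ℚ ⟩
  suc (K ℕ.+ K) · 1ℚ              ∎
  where
  open ≡-Reasoning
  K : ℕ
  K = suc k
  w : ℚ
  w = + 1 / suc k

twoPlusUnitFraction-≤ : ∀ k x → suc (suc k ℕ.+ suc k) · 1ℚ ≤ suc k · x → (+ 2 / 1) + (+ 1 / suc k) ≤ x
twoPlusUnitFraction-≤ k x bound = ℚP.≮⇒≥ λ x< →
  ℚP.<-irrefl refl (ℚP.≤-<-trans bound (subst (suc k · x <_) (·-twoPlusUnitFraction k) (·-monoʳ-< k x<)))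

sumSubsets-cong : ∀ {n} {f g : Subset n → ℚ} → (∀ I → f I ≡ g I) → sumSubsets f ≡ sumSubsets g
sumSubsets-cong {zero}  f≗g = f≗g []
sumSubsets-cong {suc n} f≗g =
  cong₂ _+_ (sumSubsets-cong (λ I → f≗g (false ∷ I))) (sumSubsets-cong (λ I → f≗g (true ∷ I)))

sumSubsets-mono : ∀ {n} {f g : Subset n → ℚ} → (∀ I → f I ≤ g I) → sumSubsets f ≤ sumSubsets g
sumSubsets-mono {zero}  f≤g = f≤g []
sumSubsets-mono {suc n} f≤g =
  ℚP.+-mono-≤ (sumSubsets-mono (λ I → f≤g (false ∷ I))) (sumSubsets-mono (λ I → f≤g (true ∷ I)))

sumSubsets-zero : ∀ {n} {f : Subset n → ℚ} → (∀ I → f I ≡ 0ℚ) → sumSubsets f ≡ 0ℚ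
sumSubsets-zero {zero}  f≗0 = f≗0 []
sumSubsets-zero {suc n} f≗0 =
  cong₂ _+_ (sumSubsets-zero (λ I → f≗0 (false ∷ I))) (sumSubsets-zero (λ I → f≗0 (true ∷ I)))

sumSubsets-∑ : ∀ {n N} (f : Fin N → Subset n → ℚ) →
               sumSubsets (λ I → ∑[ j < N ] f j I) ≡ ∑[ j < N ] sumSubsets (f j)
sumSubsets-∑ {zero}  f = refl
sumSubsets-∑ {suc n} f = trans
  (cong₂ _+_ (sumSubsets-∑ (λ j I → f j (false ∷ I))) (sumSubsets-∑ (λ j I → f j (true ∷ I))))
  (sym (∑-distrib-+ (λ j → sumSubsets (λ I → f j (false ∷ I))) (λ j → sumSubsets (λ I → f j (true ∷ I)))))

sumSubsets-· : ∀ {n} m (f : Subset n → ℚ) → sumSubsets (λ I → m · f I) ≡ m · sumSubsets f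
sumSubsets-· m f = begin
  sumSubsets (λ I → m · f I)                 ≡⟨ sumSubsets-cong (λ I → sym (sum-replicate m {f I})) ⟩
  sumSubsets (λ I → sum (replicate m (f I))) ≡⟨ sumSubsets-∑ {N = m} (λ _ → f) ⟩
  sum (replicate m (sumSubsets f))           ≡⟨ sum-replicate m ⟩
  m · sumSubsets f                           ∎
  where open ≡-Reasoning

sumSubsets-single : ∀ {n} {f : Subset n → ℚ} S → (∀ I → I ≢ S → f I ≡ 0ℚ) → sumSubsets f ≡ f S
sumSubsets-single [] _ = refl
sumSubsets-single (false ∷ S) off = trans
  (cong₂ _+_ (sumSubsets-single S (λ I I≢S → off (false ∷ I) (I≢S ∘ ∷-injectiveʳ)))
             (sumSubsets-zero (λ I → off (true ∷ I) (λ ()))))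
  (ℚP.+-identityʳ _)
sumSubsets-single (true ∷ S) off = trans
  (cong₂ _+_ (sumSubsets-zero (λ I → off (false ∷ I) (λ ())))
             (sumSubsets-single S (λ I I≢S → off (true ∷ I) (I≢S ∘ ∷-injectiveʳ))))
  (ℚP.+-identityˡ _)

module _ {A : Set} (step : A → Bool → Bool) (R : A → Set) where

  foldr-conj-sound : (∀ x b → step x b ≡ true → R x × b ≡ true) →
    ∀ {m} b (xs : Vec A m) → foldr _ step b xs ≡ true → b ≡ true × (∀ {x} → x ∈ xs → R x)
  foldr-conj-sound sound b []       holds = holds , λ ()
  foldr-conj-sound sound b (y ∷ xs) holds with sound y _ holds
  ... | Ry , rest with foldr-conj-sound sound b xs rest
  ...   | b≡true , Rxs = b≡true , λ { (here refl) → Ry ; (there x∈xs) → Rxs x∈xs }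

  foldr-conj-complete : (∀ x b → R x → b ≡ true → step x b ≡ true) →
    ∀ {m} b (xs : Vec A m) → b ≡ true → (∀ x → R x) → foldr _ step b xs ≡ true
  foldr-conj-complete complete b []       b≡true R-all = b≡true
  foldr-conj-complete complete b (y ∷ xs) b≡true R-all =
    complete y _ (R-all y) (foldr-conj-complete complete b xs b≡true R-all)

∧-true : ∀ {x y} → x ∧ y ≡ true → x ≡ true × y ≡ true
∧-true {true} {true} _ = refl , refl

module _ {n} (G : Graph n) (I : Subset n) where

  private
    compatible : Fin n → Fin n → Bool
    compatible u v = not (lookup I u ∧ lookup I v ∧ adj G u v)

    pairsFrom : ∀ {m} → Vec (Fin n) m → Fin n → Bool → Bool
    pairsFrom vs u b = foldr _ (λ v b′ → compatible u v ∧ b′) b vs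

  independent-sound : independent G I ≡ true →
    ∀ u v → lookup I u ≡ true → lookup I v ≡ true → adj G u v ≡ false
  independent-sound indep u v Iu Iv = noEdge (allCompatible (∈-allFin⁺ u) (∈-allFin⁺ v))
    where
    vs : Vec (Fin n) n
    vs = allFin n
    rowSound : ∀ u b → pairsFrom vs u b ≡ true → (∀ {v} → v ∈ vs → compatible u v ≡ true) × b ≡ true
    rowSound u b holds with foldr-conj-sound (λ v b′ → compatible u v ∧ b′) (λ v → compatible u v ≡ true)
                              (λ _ _ → ∧-true) b vs holds
    ... | b≡true , row = row , b≡true
    allCompatible : ∀ {u v} → u ∈ vs → v ∈ vs → compatible u v ≡ true
    allCompatible u∈vs = proj₂ (foldr-conj-sound (pairsFrom vs) (λ u → ∀ {v} → v ∈ vs → compatible u v ≡ true)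
                             rowSound true vs indep) u∈vs
    noEdge : compatible u v ≡ true → adj G u v ≡ false
    noEdge compat rewrite Iu | Iv with adj G u v
    ... | false = refl
    ... | true  = case compat of λ ()

  independent-complete : (∀ u v → lookup I u ≡ true → lookup I v ≡ true → adj G u v ≡ false) →
    independent G I ≡ true
  independent-complete noEdge =
    foldr-conj-complete (pairsFrom vs) (λ u → ∀ v → compatible u v ≡ true)
      (λ u b row b≡true → foldr-conj-complete _ (λ v → compatible u v ≡ true)
                             (λ v b′ c b′≡true → subst (λ z → z ∧ b′ ≡ true) (sym c) b′≡true) b vs b≡true row)
      true vs refl compatibleAll
    where
    vs : Vec (Fin n) n
    vs = allFin n
    compatibleAll : ∀ u v → compatible u v ≡ true
    compatibleAll u v with lookup I u in Iu | lookup I v in Iv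
    ... | false | _     = refl
    ... | true  | false = refl
    ... | true  | true  rewrite noEdge u v Iu Iv = refl

-- Odd closed walks

toℕ-next : ∀ {K} (p : Fin (suc K)) → toℕ (next p) ≡ suc (toℕ p) % suc K
toℕ-next p = FinP.toℕ-fromℕ< _

cyclic-fromℕ : ∀ {A : Set} (R : A → A → Set) (F : ℕ → A) {K} →
               (∀ t → t ℕ.≤ K → R (F t) (F (suc t))) → F (suc K) ≡ F 0 →
               ∀ (p : Fin (suc K)) → R (F (toℕ p)) (F (toℕ (next p)))
cyclic-fromℕ R F {K} consecutive period p with ℕP.m≤n⇒m<n∨m≡n (ℕP.≤-pred (FinP.toℕ<n p))
... | inj₁ p<K = subst (R (F (toℕ p)) ∘ F) (sym (trans (toℕ-next p) (m≤n⇒m%n≡m p<K))) (consecutive (toℕ p) (ℕP.<⇒≤ p<K))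
... | inj₂ p≡K = subst (R (F (toℕ p)) ∘ F) (sym (trans (toℕ-next p) (trans (cong (λ t → suc t % suc K) p≡K) (n%n≡0 (suc K)))))
                   (subst (R (F (toℕ p))) (trans (cong (F ∘ suc) p≡K) period) (consecutive (toℕ p) (ℕP.≤-reflexive p≡K)))

next-inject₁ : ∀ {K} (p : Fin K) → next (Fin.inject₁ p) ≡ suc p
next-inject₁ {K} p = FinP.toℕ-injective (begin
  toℕ (next (Fin.inject₁ p))      ≡⟨ toℕ-next (Fin.inject₁ p) ⟩
  suc (toℕ (Fin.inject₁ p)) % suc K ≡⟨ cong (λ t → suc t % suc K) (FinP.toℕ-inject₁ p) ⟩
  suc (toℕ p) % suc K             ≡⟨ m≤n⇒m%n≡m (FinP.toℕ<n p) ⟩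
  suc (toℕ p)                     ∎)
  where open ≡-Reasoning

next-fromℕ : ∀ K → next (Fin.fromℕ K) ≡ zero
next-fromℕ K = FinP.toℕ-injective (begin
  toℕ (next (Fin.fromℕ K))      ≡⟨ toℕ-next (Fin.fromℕ K) ⟩
  suc (toℕ (Fin.fromℕ K)) % suc K ≡⟨ cong (λ t → suc t % suc K) (FinP.toℕ-fromℕ K) ⟩
  suc K % suc K                 ≡⟨ n%n≡0 (suc K) ⟩
  0                             ∎)
  where open ≡-Reasoning

ℕsum-rotate : ∀ {K} (f : Fin (suc K) → ℕ) → ℕΣ.sum (f ∘ next) ≡ ℕΣ.sum f
ℕsum-rotate {K} f = begin
  ℕΣ.sum (f ∘ next)                                       ≡⟨ ℕΣ.sum-init-last (f ∘ next) ⟩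
  ℕΣ.sum (f ∘ next ∘ Fin.inject₁) ℕ.+ f (next (Fin.fromℕ K)) ≡⟨ cong₂ ℕ._+_ (ℕΣ.sum-cong-≗ (cong f ∘ next-inject₁))
                                                                         (cong f (next-fromℕ K)) ⟩
  ℕΣ.sum (f ∘ suc) ℕ.+ f zero                               ≡⟨ ℕP.+-comm (ℕΣ.sum (f ∘ suc)) (f zero) ⟩
  ℕΣ.sum f                                                  ∎
  where open ≡-Reasoning

countTrue : ∀ {N} → (Fin N → Bool) → ℕ
countTrue b = ℕΣ.sum (λ p → if b p then 1 else 0)

∑-if : ∀ {N} (b : Fin N → Bool) x → ∑[ p < N ] (if b p then x else 0ℚ) ≡ countTrue b · x
∑-if {zero}  b x = refl
∑-if {suc N} b x with b zero
... | true  = cong (λ z → x + z) (∑-if (b ∘ suc) x)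
... | false = trans (ℚP.+-identityˡ _) (∑-if (b ∘ suc) x)

∑-≥ : ∀ {N} (f : Fin N → ℚ) → (∀ p → 1ℚ ≤ f p) → N · 1ℚ ≤ ∑[ p < N ] f p
∑-≥ {zero}  f 1≤f = ℚP.≤-refl
∑-≥ {suc N} f 1≤f = ℚP.+-mono-≤ (1≤f zero) (∑-≥ (f ∘ suc) (1≤f ∘ suc))

countTrue-noConsecutive : ∀ {K} (b : Fin (suc K) → Bool) → (∀ p → b p ∧ b (next p) ≡ false) →
                          countTrue b ℕ.+ countTrue b ℕ.≤ suc K
countTrue-noConsecutive {K} b apart = begin
  countTrue b ℕ.+ countTrue b                     ≡⟨ cong (countTrue b ℕ.+_) (sym (ℕsum-rotate χ)) ⟩
  countTrue b ℕ.+ ℕΣ.sum (χ ∘ next)               ≡⟨ sym (ℕΣ.∑-distrib-+ χ (χ ∘ next)) ⟩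
  ℕΣ.sum (λ p → χ p ℕ.+ χ (next p))               ≤⟨ ℕsum-≤-length (λ p → pairAtMostOne (b p) (b (next p)) (apart p)) ⟩
  suc K                                           ∎
  where
  open ℕP.≤-Reasoning
  χ : Fin (suc K) → ℕ
  χ p = if b p then 1 else 0
  pairAtMostOne : ∀ x y → x ∧ y ≡ false → (if x then 1 else 0) ℕ.+ (if y then 1 else 0) ℕ.≤ 1
  pairAtMostOne true  false _ = ℕP.≤-refl
  pairAtMostOne false true  _ = ℕP.≤-refl
  pairAtMostOne false false _ = z≤n
  ℕsum-≤-length : ∀ {N} {f : Fin N → ℕ} → (∀ p → f p ℕ.≤ 1) → ℕΣ.sum f ℕ.≤ N
  ℕsum-≤-length {zero}  f≤1 = z≤n
  ℕsum-≤-length {suc N} f≤1 = ℕP.+-mono-≤ (f≤1 zero) (ℕsum-≤-length (f≤1 ∘ suc))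

half-≤ : ∀ c m → c ℕ.+ c ℕ.≤ suc (m ℕ.+ m) → c ℕ.≤ m
half-≤ c m c+c≤ = ℕP.≮⇒≥ λ m<c → ℕP.<-irrefl refl (ℕP.≤-trans
  (ℕP.≤-reflexive (cong suc (sym (ℕP.+-suc m m)))) (ℕP.≤-trans (ℕP.+-mono-≤ m<c m<c) c+c≤))

ClosedWalk : ∀ {n} → Graph n → ∀ {K} → (Fin (suc K) → Fin n) → Set
ClosedWalk G w = ∀ p → Adj G (w p) (w (next p))

module _ {n} (G : Graph n) where

  independent-oddWalk : ∀ {I K m} {w : Fin (suc K) → Fin n} → K ≡ m ℕ.+ m → independent G I ≡ true →
                        ClosedWalk G w → countTrue (λ p → lookup I (w p)) ℕ.≤ m
  independent-oddWalk {I} {K} {m} {w} refl indep walk =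
    half-≤ _ m (countTrue-noConsecutive (λ p → lookup I (w p)) apart)
    where
    apart : ∀ p → lookup I (w p) ∧ lookup I (w (next p)) ≡ false
    apart p with lookup I (w p) in Iu | lookup I (w (next p)) in Iv
    ... | false | _     = refl
    ... | true  | false = refl
    ... | true  | true  = case trans (sym (walk p)) (independent-sound G I indep _ _ Iu Iv) of λ ()

  feasible-oddWalk : ∀ {y K m} {w : Fin (suc K) → Fin n} → K ≡ m ℕ.+ m → Feasible G y → ClosedWalk G w →
                     suc K · 1ℚ ≤ m · objective G y
  feasible-oddWalk {y} {K} {m} {w} K≡2m (y≥0 , covers) walk = begin
    suc K · 1ℚ                                                  ≤⟨ ∑-≥ _ (covers ∘ w) ⟩
    ∑[ p < suc K ] sumSubsets (λ I → hit I p)                   ≡⟨ sumSubsets-∑ (λ p I → hit I p) ⟨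
    sumSubsets (λ I → ∑[ p < suc K ] hit I p)                   ≤⟨ sumSubsets-mono hitsAtMost ⟩
    sumSubsets (λ I → m · (if independent G I ∧ true then y I else 0ℚ)) ≡⟨ sumSubsets-· m (λ I → if independent G I ∧ true then y I else 0ℚ) ⟩
    m · objective G y                                           ∎
    where
    open ℚP.≤-Reasoning
    hit : Subset n → Fin (suc K) → ℚ
    hit I p = if independent G I ∧ lookup I (w p) then y I else 0ℚ
    hitsAtMost : ∀ I → ∑[ p < suc K ] hit I p ≤ m · (if independent G I ∧ true then y I else 0ℚ)
    hitsAtMost I with independent G I in indep
    ... | true  = ℚP.≤-trans (ℚP.≤-reflexive (∑-if (λ p → lookup I (w p)) (y I)))
                    (·-monoˡ-≤ (y≥0 I indep) (independent-oddWalk {I} {K} {m} K≡2m indep walk))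
    ... | false = ℚP.≤-trans (ℚP.≤-reflexive (sum-replicate-zero (suc K))) (·-monoˡ-≤ ℚP.≤-refl (z≤n {m}))

  fractional-oddWalk : ∀ {y K k} {w : Fin (suc K) → Fin n} → K ≡ suc k ℕ.+ suc k → Feasible G y → ClosedWalk G w →
                       (+ 2 / 1) + (+ 1 / suc k) ≤ objective G y
  fractional-oddWalk {k = k} refl feasible walk =
    twoPlusUnitFraction-≤ k _ (feasible-oddWalk {m = suc k} refl feasible walk)

-- Fractional colourings from multicolourings

_≟ₛ_ : ∀ {n} (I J : Subset n) → Dec (I ≡ J)
_≟ₛ_ = Vec-≡-dec BoolP._≟_

module Multicolouring {n} (G : Graph n) {N k} (S : Fin N → Subset n)
                      (S-independent : ∀ j → independent G (S j) ≡ true)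
                      (S-covers : ∀ v → suc k ℕ.≤ countTrue (λ j → lookup (S j) v)) where

  weight : ℚ
  weight = + 1 / suc k

  weight≥0 : 0ℚ ≤ weight
  weight≥0 = ℚP.nonNegative⁻¹ weight {{ℚP.normalize-nonNeg 1 (suc k)}}

  y : Subset n → ℚ
  y I = ∑[ j < N ] (if does (I ≟ₛ S j) then weight else 0ℚ)

  sumIndep-y : ∀ P → sumIndep G P y ≡ ∑[ j < N ] (if P (S j) then weight else 0ℚ)
  sumIndep-y P = begin
    sumSubsets (λ I → if indep∧P I then y I else 0ℚ)                         ≡⟨ sumSubsets-cong (λ I → if-∑ {I} (indep∧P I)) ⟩
    sumSubsets (λ I → ∑[ j < N ] term j I)                                 ≡⟨ sumSubsets-∑ term ⟩
    ∑[ j < N ] sumSubsets (term j)                                         ≡⟨ sum-cong-≗ (λ j → sumSubsets-single (S j) (offSupport j)) ⟩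
    ∑[ j < N ] term j (S j)                                                ≡⟨ sum-cong-≗ onSupport ⟩
    ∑[ j < N ] (if P (S j) then weight else 0ℚ)                            ∎
    where
    open ≡-Reasoning
    indep∧P : Subset n → Bool
    indep∧P I = independent G I ∧ P I
    term : Fin N → Subset n → ℚ
    term j I = if indep∧P I then (if does (I ≟ₛ S j) then weight else 0ℚ) else 0ℚ
    if-∑ : ∀ {I} b → (if b then y I else 0ℚ) ≡ ∑[ j < N ] (if b then (if does (I ≟ₛ S j) then weight else 0ℚ) else 0ℚ)
    if-∑ true  = refl
    if-∑ false = sym (sum-replicate-zero N)
    offSupport : ∀ j I → I ≢ S j → term j I ≡ 0ℚ
    offSupport j I I≢Sj rewrite dec-false (I ≟ₛ S j) I≢Sj with indep∧P I
    ... | true  = refl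
    ... | false = refl
    onSupport : ∀ j → term j (S j) ≡ (if P (S j) then weight else 0ℚ)
    onSupport j rewrite dec-true (S j ≟ₛ S j) refl | S-independent j = refl

  feasible : Feasible G y
  feasible = y≥0 , covers
    where
    y≥0 : ∀ I → independent G I ≡ true → 0ℚ ≤ y I
    y≥0 I _ = begin
      0 · weight                                        ≤⟨ ·-monoˡ-≤ weight≥0 (z≤n {countTrue (λ j → does (I ≟ₛ S j))}) ⟩
      countTrue (λ j → does (I ≟ₛ S j)) · weight        ≡⟨ ∑-if (λ j → does (I ≟ₛ S j)) weight ⟨
      y I                                               ∎
      where open ℚP.≤-Reasoning
    covers : ∀ v → (+ 1 / 1) ≤ sumIndep G (λ I → lookup I v) y
    covers v = begin
      + 1 / 1                                           ≡⟨ ·-unitFraction-cancel k ⟨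
      suc k · weight                                    ≤⟨ ·-monoˡ-≤ weight≥0 (S-covers v) ⟩
      countTrue (λ j → lookup (S j) v) · weight         ≡⟨ ∑-if (λ j → lookup (S j) v) weight ⟨
      ∑[ j < N ] (if lookup (S j) v then weight else 0ℚ) ≡⟨ sumIndep-y (λ I → lookup I v) ⟨
      sumIndep G (λ I → lookup I v) y                   ∎
      where open ℚP.≤-Reasoning

  objective-y : objective G y ≡ N · weight
  objective-y = trans (sumIndep-y (λ _ → true)) (sum-replicate N)

-- The odd cycle and its colouring by 2m+1 independent sets

even : ℕ → Bool
even zero          = true
even (suc zero)    = false
even (suc (suc n)) = even n

even-suc : ∀ n → even (suc n) ≡ not (even n)
even-suc zero          = refl
even-suc (suc zero)    = refl
even-suc (suc (suc n)) = even-suc n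

even-double : ∀ m → even (m ℕ.+ m) ≡ true
even-double zero    = refl
even-double (suc m) = trans (cong (even ∘ suc) (ℕP.+-suc m m)) (even-double m)

sameParity : ℕ → ℕ → Bool
sameParity j a = not (even j xor even a)

sameParity-suc : ∀ j a → sameParity j (suc a) ≡ not (sameParity j a)
sameParity-suc j a rewrite even-suc a with even j | even a
... | true  | true  = refl
... | true  | false = refl
... | false | true  = refl
... | false | false = refl

sameParity-shift : ∀ j a → sameParity (suc j) (suc a) ≡ sameParity j a
sameParity-shift j a rewrite even-suc j | even-suc a with even j | even a
... | true  | true  = refl
... | true  | false = refl
... | false | true  = refl
... | false | false = refl

<ᵇ-true : ∀ {m n} → m ℕ.< n → (m ℕ.<ᵇ n) ≡ true
<ᵇ-true {zero}  {suc n} _         = refl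
<ᵇ-true {suc m} {suc n} (s≤s m<n) = <ᵇ-true m<n

<ᵇ-false : ∀ {m n} → n ℕ.≤ m → (m ℕ.<ᵇ n) ≡ false
<ᵇ-false {m}     {zero}  _         = refl
<ᵇ-false {suc m} {suc n} (s≤s n≤m) = <ᵇ-false n≤m

-- Vertex a of the cycle 0, 1, …, 2m lies in class j iff a ∈ {j+2, j+4, …, j+2m} modulo 2m+1.
cycleClass : ℕ → ℕ → Bool
cycleClass j a = ((j ℕ.<ᵇ a) ∧ sameParity j a) ∨ ((a ℕ.<ᵇ j) ∧ not (sameParity j a))

data CycleEdge (top : ℕ) : ℕ → ℕ → Set where
  step : ∀ {a} → CycleEdge top a (suc a)
  wrap : CycleEdge top top 0

CycleAdj : ℕ → ℕ → ℕ → Set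
CycleAdj top a b = CycleEdge top a b ⊎ CycleEdge top b a

cycleClass-step : ∀ j a → cycleClass j a ∧ cycleClass j (suc a) ≡ false
cycleClass-step j a with ℕP.<-cmp j a
... | tri< j<a _ _
  rewrite <ᵇ-true j<a | <ᵇ-true (ℕP.m<n⇒m<1+n j<a) | <ᵇ-false (ℕP.<⇒≤ j<a)
        | <ᵇ-false {suc a} (ℕP.m≤n⇒m≤1+n (ℕP.<⇒≤ j<a)) | sameParity-suc j a with sameParity j a
...   | true  = refl
...   | false = refl
cycleClass-step j a | tri≈ _ refl _ rewrite <ᵇ-false (ℕP.≤-refl {j}) = refl
cycleClass-step j a | tri> _ _ a<j with ℕP.m≤n⇒m<n∨m≡n a<j
... | inj₂ refl rewrite <ᵇ-false (ℕP.≤-refl {j}) = BoolP.∧-zeroʳ _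
... | inj₁ sa<j rewrite <ᵇ-false (ℕP.<⇒≤ a<j) | <ᵇ-false (ℕP.<⇒≤ sa<j) | <ᵇ-true a<j | <ᵇ-true sa<j
                      | sameParity-suc j a with sameParity j a
...   | true  = refl
...   | false = refl

cycleClass-wrap : ∀ {top j} → even top ≡ true → j ℕ.≤ top → cycleClass j top ∧ cycleClass j 0 ≡ false
cycleClass-wrap {top} {j} top-even j≤top rewrite <ᵇ-false j≤top | top-even
  with j ℕ.<ᵇ top | 0 ℕ.<ᵇ j | even j
... | _     | false | _     = BoolP.∧-zeroʳ _
... | false | true  | _     = refl
... | true  | true  | true  = refl
... | true  | true  | false = refl

cycleClass-edge : ∀ {top j a b} → even top ≡ true → j ℕ.≤ top → CycleAdj top a b →
                  cycleClass j a ∧ cycleClass j b ≡ false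
cycleClass-edge {j = j} {a} _        _     (inj₁ step) = cycleClass-step j a
cycleClass-edge {j = j} {b = b} _    _     (inj₂ step) = trans (BoolP.∧-comm (cycleClass j (suc b)) _) (cycleClass-step j b)
cycleClass-edge top-even j≤top (inj₁ wrap) = cycleClass-wrap top-even j≤top
cycleClass-edge {j = j} top-even j≤top (inj₂ wrap) =
  trans (BoolP.∧-comm (cycleClass j 0) _) (cycleClass-wrap top-even j≤top)

classCount : ℕ → ℕ → ℕ
classCount top a = countTrue {suc top} (λ j → cycleClass (toℕ j) a)

cycleClass-shift : ∀ j a → cycleClass (suc j) (suc a) ≡ cycleClass j a
cycleClass-shift j a rewrite sameParity-shift j a = refl

cycleClass-rotate : ∀ {top a} → a ℕ.< top → even top ≡ true → cycleClass 0 (suc a) ≡ cycleClass top a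
cycleClass-rotate {top} {a} a<top top-even
  rewrite <ᵇ-true a<top | <ᵇ-false {top} (ℕP.<⇒≤ a<top) | top-even | even-suc a with even a
... | true  = refl
... | false = refl

cycleClass-zero : ∀ j → cycleClass j 0 ≡ not (even j)
cycleClass-zero zero    = refl
cycleClass-zero (suc j) with even (suc j)
... | true  = refl
... | false = refl

classCount-suc : ∀ {top a} → a ℕ.< top → even top ≡ true → classCount top (suc a) ≡ classCount top a
classCount-suc {top} {a} a<top top-even = begin
  classCount top (suc a)                              ≡⟨⟩
  χ (cycleClass 0 (suc a)) ℕ.+ ℕΣ.sum {top} (χ ∘ atPosition (suc a) ∘ suc ∘ toℕ)
    ≡⟨ cong₂ ℕ._+_ (cong χ (cycleClass-rotate a<top top-even))
                   (ℕΣ.sum-cong-≗ {top} (λ j → cong χ (cycleClass-shift (toℕ j) a))) ⟩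
  χ (cycleClass top a) ℕ.+ ℕΣ.sum {top} (χ ∘ atPosition a ∘ toℕ)
    ≡⟨ ℕP.+-comm (χ (cycleClass top a)) (ℕΣ.sum {top} (χ ∘ atPosition a ∘ toℕ)) ⟩
  ℕΣ.sum {top} (χ ∘ atPosition a ∘ toℕ) ℕ.+ χ (cycleClass top a)
    ≡⟨ cong₂ ℕ._+_ (ℕΣ.sum-cong-≗ {top} (λ j → cong (χ ∘ atPosition a) (sym (FinP.toℕ-inject₁ j))))
                   (cong (χ ∘ atPosition a) (sym (FinP.toℕ-fromℕ top))) ⟩
  ℕΣ.sum {top} (χ ∘ atPosition a ∘ toℕ ∘ Fin.inject₁) ℕ.+ χ (atPosition a (toℕ (Fin.fromℕ top)))
    ≡⟨ ℕΣ.sum-init-last (χ ∘ atPosition a ∘ toℕ) ⟨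
  classCount top a                                    ∎
  where
  open ≡-Reasoning
  χ : Bool → ℕ
  χ b = if b then 1 else 0
  atPosition : ℕ → ℕ → Bool
  atPosition a j = cycleClass j a

oddsBelow : ℕ → ℕ
oddsBelow N = countTrue {N} (λ j → not (even (toℕ j)))

oddsBelow-double : ∀ m → oddsBelow (suc (m ℕ.+ m)) ≡ m
oddsBelow-double zero    = refl
oddsBelow-double (suc m) = cong suc (trans (cong oddsBelow (ℕP.+-suc m m)) (oddsBelow-double m))

classCount-double : ∀ m {a} → a ℕ.≤ m ℕ.+ m → classCount (m ℕ.+ m) a ≡ m
classCount-double m {zero}  _ = trans (ℕΣ.sum-cong-≗ {suc (m ℕ.+ m)} (λ j → cong (λ b → if b then 1 else 0) (cycleClass-zero (toℕ j))))
                                      (oddsBelow-double m)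
classCount-double m {suc a} a<top = trans (classCount-suc a<top (even-double m)) (classCount-double m (ℕP.<⇒≤ a<top))

module _ {n} (G : Graph n) {k} (pos : Fin n → ℕ) (pos≤ : ∀ v → pos v ℕ.≤ suc k ℕ.+ suc k)
         (hom : ∀ {u v} → Adj G u v → CycleAdj (suc k ℕ.+ suc k) (pos u) (pos v)) where

  private
    classes : Fin (suc (suc k ℕ.+ suc k)) → Subset n
    classes j = tabulate (λ v → cycleClass (toℕ j) (pos v))

    classes-independent : ∀ j → independent G (classes j) ≡ true
    classes-independent j = independent-complete G (classes j) noEdge
      where
      noEdge : ∀ u v → lookup (classes j) u ≡ true → lookup (classes j) v ≡ true → adj G u v ≡ false
      noEdge u v ju jv with adj G u v in uv
      ... | false = refl
      ... | true  = case trans (sym (cong₂ _∧_ (trans (sym (lookup∘tabulate _ u)) ju) (trans (sym (lookup∘tabulate _ v)) jv)))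
                               (cycleClass-edge (even-double (suc k)) (ℕP.≤-pred (FinP.toℕ<n j)) (hom uv)) of λ ()

    classes-cover : ∀ v → suc k ℕ.≤ countTrue (λ j → lookup (classes j) v)
    classes-cover v = ℕP.≤-reflexive (sym (trans
      (ℕΣ.sum-cong-≗ {suc (suc k ℕ.+ suc k)} (λ j → cong (λ b → if b then 1 else 0) (lookup∘tabulate (λ u → cycleClass (toℕ j) (pos u)) v)))
      (classCount-double (suc k) (pos≤ v))))

    open Multicolouring G classes classes-independent classes-cover

  cycleHomomorphism-fractional : ∀ r → IsFractionalChromaticNumber G r → r ≤ (+ 2 / 1) + (+ 1 / suc k)
  cycleHomomorphism-fractional r (_ , optimal) = begin
    r                                         ≤⟨ optimal y feasible ⟩
    objective G y                             ≡⟨ objective-y ⟩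
    suc (suc k ℕ.+ suc k) · (+ 1 / suc k)     ≡⟨ ·-oddUnitFraction k ⟩
    (+ 2 / 1) + (+ 1 / suc k)                 ∎
    where open ℚP.≤-Reasoning

-- Distance layers around a colour class

threeAvoiding-collide : ∀ {i a b c : Fin 3} → a ≢ i → b ≢ i → c ≢ i → a ≡ b ⊎ a ≡ c ⊎ b ≡ c
threeAvoiding-collide {i} {a} {b} {c} a≢i b≢i c≢i with pigeonhole (s≤s (s≤s (s≤s z≤n))) into
  where
  into : Fin 3 → Fin 2
  into zero             = punchOut (a≢i ∘ sym)
  into (suc zero)       = punchOut (b≢i ∘ sym)
  into (suc (suc zero)) = punchOut (c≢i ∘ sym)
... | zero     , suc zero       , _ , eq = inj₁ (punchOut-injective (a≢i ∘ sym) (b≢i ∘ sym) eq)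
... | zero     , suc (suc zero) , _ , eq = inj₂ (inj₁ (punchOut-injective (a≢i ∘ sym) (c≢i ∘ sym) eq))
... | suc zero , suc (suc zero) , _ , eq = inj₂ (inj₂ (punchOut-injective (b≢i ∘ sym) (c≢i ∘ sym) eq))
... | zero           , zero           , () , _
... | suc zero       , zero           , () , _
... | suc zero       , suc zero       , s≤s () , _
... | suc (suc zero) , zero           , () , _
... | suc (suc zero) , suc zero       , s≤s () , _
... | suc (suc zero) , suc (suc zero) , s≤s (s≤s ()) , _

Adj-sym : ∀ {n} (G : Graph n) {u v} → Adj G u v → Adj G v u
Adj-sym G {u} {v} uv = trans (Graph.sym G v u) uv

contractMap-inside : ∀ {n k} (c : Fin n → Fin k) {i w} → c w ≡ i → contractMap c i w ≡ nothing
contractMap-inside c {i} {w} cw≡i with c w Fin.≟ i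
... | yes _    = refl
... | no cw≢i = ⊥-elim (cw≢i cw≡i)

contractMap-outside : ∀ {n k} (c : Fin n → Fin k) {i w} → c w ≢ i → contractMap c i w ≡ just w
contractMap-outside c {i} {w} cw≢i with c w Fin.≟ i
... | yes cw≡i = ⊥-elim (cw≢i cw≡i)
... | no _     = refl

otherThan : Fin 3 → Fin 3
otherThan zero    = suc zero
otherThan (suc _) = zero

otherThan-≢ : ∀ i → otherThan i ≢ i
otherThan-≢ zero    ()
otherThan-≢ (suc _) ()

side : Fin 3 → Fin 3 → Bool
side i a = does (a Fin.≟ otherThan i)

side-flip : ∀ {i a b} → a ≢ i → b ≢ i → a ≢ b → side i a ≡ not (side i b)
side-flip {i} {a} {b} a≢i b≢i a≢b with threeAvoiding-collide a≢i b≢i (otherThan-≢ i)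
... | inj₁ a≡b = ⊥-elim (a≢b a≡b)
... | inj₂ (inj₁ a≡o) rewrite dec-true (a Fin.≟ otherThan i) a≡o
                            | dec-false (b Fin.≟ otherThan i) (a≢b ∘ trans a≡o ∘ sym) = refl
... | inj₂ (inj₂ b≡o) rewrite dec-true (b Fin.≟ otherThan i) b≡o
                            | dec-false (a Fin.≟ otherThan i) (a≢b ∘ flip trans (sym b≡o)) = refl

oddLength : ∀ e → suc (suc e ℕ.+ suc e) ≡ suc (suc (suc (e * 2)))
oddLength e = cong (λ x → ℕ.suc (ℕ.suc x)) (trans (ℕP.+-suc e e)
  (cong ℕ.suc (trans (cong (e ℕ.+_) (sym (ℕP.+-identityʳ e))) (ℕP.*-comm 2 e))))

module Layers {n} (G : Graph n) (c : Fin n → Fin 3) (proper : ProperColoring G 3 c) (i : Fin 3) (k : ℕ) where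

  Within : ℕ → Fin n → Set
  Within zero    v = c v ≡ i
  Within (suc j) v = Within j v ⊎ Σ (Fin n) λ w → Adj G v w × Within j w

  within? : ∀ j v → Dec (Within j v)
  within? zero    v = c v Fin.≟ i
  within? (suc j) v = within? j v ⊎-dec FinP.any? (λ w → (adj G v w BoolP.≟ true) ×-dec within? j w)

  leastWithin : ∀ v t → Σ ℕ λ d → d ℕ.≤ t × (d ℕ.< t → Within d v) × (∀ {j} → j ℕ.< d → ¬ Within j v)
  leastWithin v zero = 0 , z≤n , (λ ()) , (λ ())
  leastWithin v (suc t) with leastWithin v t
  ... | d , d≤t , within , below with ℕP.m≤n⇒m<n∨m≡n d≤t
  ...   | inj₁ d<t = d , ℕP.m≤n⇒m≤1+n d≤t , (λ _ → within d<t) , below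
  ...   | inj₂ refl with within? d v
  ...     | yes w = d , ℕP.n≤1+n d , (λ _ → w) , below
  ...     | no ¬w = suc d , ℕP.≤-refl , (λ d<d → ⊥-elim (ℕP.<-irrefl refl d<d)) , below′
    where
    below′ : ∀ {j} → j ℕ.< suc d → ¬ Within j v
    below′ j<sd with ℕP.m<1+n⇒m<n∨m≡n j<sd
    ... | inj₁ j<d  = below j<d
    ... | inj₂ refl = ¬w

  -- The distance from colour class i, truncated at suc k (which is ρ_i − 1).
  depth : Fin n → ℕ
  depth v = proj₁ (leastWithin v (suc k))

  depth-≤ : ∀ v → depth v ℕ.≤ suc k
  depth-≤ v = proj₁ (proj₂ (leastWithin v (suc k)))

  depth-within : ∀ v → depth v ℕ.< suc k → Within (depth v) v
  depth-within v = proj₁ (proj₂ (proj₂ (leastWithin v (suc k))))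

  depth-least : ∀ {j v} → Within j v → depth v ℕ.≤ j
  depth-least {j} {v} w = ℕP.≮⇒≥ (λ j<depth → proj₂ (proj₂ (proj₂ (leastWithin v (suc k)))) j<depth w)

  depth≡0 : ∀ {v} → c v ≡ i → depth v ≡ 0
  depth≡0 cv≡i = ℕP.n≤0⇒n≡0 (depth-least {0} cv≡i)

  depth≡0⇒colour : ∀ {v} → depth v ≡ 0 → c v ≡ i
  depth≡0⇒colour {v} d≡0 with depth-within v (subst (ℕ._< suc k) (sym d≡0) (s≤s z≤n))
  ... | w rewrite d≡0 = w

  depth>0⇒colour≢ : ∀ {v} → 1 ℕ.≤ depth v → c v ≢ i
  depth>0⇒colour≢ 1≤d cv≡i = ℕP.<-irrefl (sym (depth≡0 cv≡i)) 1≤d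

  depth-adj : ∀ {u v} → Adj G u v → depth u ℕ.≤ suc (depth v)
  depth-adj {u} {v} uv with ℕP.m≤n⇒m<n∨m≡n (depth-≤ v)
  ... | inj₁ dv<K = depth-least {suc (depth v)} (inj₂ (v , uv , depth-within v dv<K))
  ... | inj₂ dv≡K = ℕP.≤-trans (depth-≤ u) (ℕP.≤-trans (ℕP.n≤1+n (suc k)) (ℕP.≤-reflexive (cong suc (sym dv≡K))))

  depth-parent : ∀ {v d} → depth v ≡ suc d → suc d ℕ.< suc k → Σ (Fin n) λ w → Adj G v w × depth w ≡ d
  depth-parent {v} {d} dv≡ sd<K with subst (λ j → Within j v) dv≡ (depth-within v (subst (ℕ._< suc k) (sym dv≡) sd<K))
  ... | inj₁ within-d = ⊥-elim (ℕP.<-irrefl refl (ℕP.≤-trans (ℕP.≤-reflexive (sym dv≡)) (depth-least within-d)))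
  ... | inj₂ (w , vw , within-w) = w , vw , ℕP.≤-antisym (depth-least within-w) d≤dw
    where
    d≤dw : d ℕ.≤ depth w
    d≤dw = ℕP.≮⇒≥ λ dw<d → ℕP.<⇒≱ dw<d (ℕP.≤-pred (ℕP.≤-trans (ℕP.≤-reflexive (sym dv≡))
             (depth-least {suc (depth w)} (inj₂ (w , vw , depth-within w (ℕP.<-trans dw<d (ℕP.<-trans (ℕP.n<1+n d) sd<K)))))))

  record Geodesic (v : Fin n) (d : ℕ) : Set where
    field
      vertex       : ℕ → Fin n
      vertex-top   : vertex d ≡ v
      vertex-depth : ∀ {j} → j ℕ.≤ d → depth (vertex j) ≡ j
      vertex-adj   : ∀ {j} → j ℕ.< d → Adj G (vertex (suc j)) (vertex j)

  extend : ∀ {w v d} → Geodesic w d → Adj G v w → depth v ≡ suc d → Geodesic v (suc d)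
  extend {w} {v} {d} γ vw dv≡ = record
    { vertex = vertex′ ; vertex-top = vertex′-top ; vertex-depth = vertex′-depth ; vertex-adj = vertex′-adj }
    where
    open Geodesic γ
    vertex′ : ℕ → Fin n
    vertex′ j with j ℕ.≤? d
    ... | yes _ = vertex j
    ... | no _  = v
    vertex′-below : ∀ {j} → j ℕ.≤ d → vertex′ j ≡ vertex j
    vertex′-below {j} j≤d with j ℕ.≤? d
    ... | yes _   = refl
    ... | no j≰d = ⊥-elim (j≰d j≤d)
    vertex′-top : vertex′ (suc d) ≡ v
    vertex′-top with suc d ℕ.≤? d
    ... | yes sd≤d = ⊥-elim (ℕP.<-irrefl refl sd≤d)
    ... | no _     = refl
    vertex′-depth : ∀ {j} → j ℕ.≤ suc d → depth (vertex′ j) ≡ j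
    vertex′-depth {j} j≤sd with ℕP.m≤n⇒m<n∨m≡n j≤sd
    ... | inj₁ j<sd = trans (cong depth (vertex′-below (ℕP.≤-pred j<sd))) (vertex-depth (ℕP.≤-pred j<sd))
    ... | inj₂ refl = trans (cong depth vertex′-top) dv≡
    vertex′-adj : ∀ {j} → j ℕ.< suc d → Adj G (vertex′ (suc j)) (vertex′ j)
    vertex′-adj {j} j<sd with ℕP.m<1+n⇒m<n∨m≡n j<sd
    ... | inj₁ j<d  = subst₂ (Adj G) (sym (vertex′-below j<d)) (sym (vertex′-below (ℕP.<⇒≤ j<d))) (vertex-adj j<d)
    ... | inj₂ refl = subst₂ (Adj G) (sym vertex′-top) (sym (trans (vertex′-below ℕP.≤-refl) vertex-top)) vw

  geodesic : ∀ d {v} → depth v ≡ d → d ℕ.< suc k → Geodesic v d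
  geodesic zero {v} dv≡0 _ = record
    { vertex = λ _ → v ; vertex-top = refl
    ; vertex-depth = λ j≤0 → trans dv≡0 (sym (ℕP.n≤0⇒n≡0 j≤0)) ; vertex-adj = λ () }
  geodesic (suc d) dv≡ sd<K with depth-parent dv≡ sd<K
  ... | w , vw , dw≡d = extend (geodesic d dw≡d (ℕP.<-trans (ℕP.n<1+n d) sd<K)) vw dv≡

  geodesic-colour≢ : ∀ {v d} (γ : Geodesic v d) {j} → 1 ℕ.≤ j → j ℕ.≤ d → c (Geodesic.vertex γ j) ≢ i
  geodesic-colour≢ γ 1≤j j≤d = depth>0⇒colour≢ (subst (1 ℕ.≤_) (sym (Geodesic.vertex-depth γ j≤d)) 1≤j)

  geodesics-colour≢ : ∀ {u v d} (γ : Geodesic u d) (δ : Geodesic v d) → c u ≢ c v →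
                      ∀ {j} → 1 ℕ.≤ j → j ℕ.≤ d → c (Geodesic.vertex γ j) ≢ c (Geodesic.vertex δ j)
  geodesics-colour≢ {u} {v} {d} γ δ cu≢cv {j} 1≤j j≤d = downFrom (d ∸ j) (ℕP.m+[n∸m]≡n j≤d) 1≤j
    where
    open Geodesic γ renaming (vertex to P)
    open Geodesic δ using () renaming (vertex to Q; vertex-top to Q-top; vertex-adj to Q-adj)
    above : ∀ {s j} → j ℕ.+ suc s ≡ d → suc j ℕ.≤ d
    above {s} {j} j+ss≡d = subst (suc j ℕ.≤_) (trans (sym (ℕP.+-suc j s)) j+ss≡d) (s≤s (ℕP.m≤m+n j s))
    downFrom : ∀ s {j} → j ℕ.+ s ≡ d → 1 ℕ.≤ j → c (P j) ≢ c (Q j)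
    downFrom zero {j} j≡d _ rewrite ℕP.+-identityʳ j | j≡d | vertex-top | Q-top = cu≢cv
    downFrom (suc s) {j} j+ss≡d 1≤j cPj≡cQj
      with threeAvoiding-collide (geodesic-colour≢ γ (s≤s z≤n) (above j+ss≡d)) (geodesic-colour≢ δ (s≤s z≤n) (above j+ss≡d))
                                 (geodesic-colour≢ γ 1≤j (ℕP.<⇒≤ (above j+ss≡d)))
    ... | inj₁ same-above = downFrom s (trans (sym (ℕP.+-suc j s)) j+ss≡d) (s≤s z≤n) same-above
    ... | inj₂ (inj₁ cP≡cP) = proper _ _ (vertex-adj (above j+ss≡d)) cP≡cP
    ... | inj₂ (inj₂ cQ≡cP) = proper _ _ (Q-adj (above j+ss≡d)) (trans cQ≡cP cPj≡cQj)

  module FlatEdge {u v e} (uv : Adj G u v) (du : depth u ≡ suc e) (dv : depth v ≡ suc e) (e<k : suc e ℕ.< suc k) where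

    private
      d L : ℕ
      d = suc e
      L = suc (d ℕ.+ d)
      γ : Geodesic u d
      γ = geodesic d du e<k
      δ : Geodesic v d
      δ = geodesic d dv e<k
      open Geodesic γ renaming (vertex to P)
      open Geodesic δ using () renaming (vertex to Q; vertex-top to Q-top; vertex-depth to Q-depth; vertex-adj to Q-adj)

    -- P 0, …, P d = u, v = Q d, …, Q 0: up one geodesic, across the flat edge, down the other.
    walk : ℕ → Fin n
    walk t with t ℕ.≤? d
    ... | yes _ = P t
    ... | no _  = Q (L ∸ t)

    walk-low : ∀ {t} → t ℕ.≤ d → walk t ≡ P t
    walk-low {t} t≤d with t ℕ.≤? d
    ... | yes _   = refl
    ... | no t≰d = ⊥-elim (t≰d t≤d)

    walk-high : ∀ {t} → d ℕ.< t → walk t ≡ Q (L ∸ t)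
    walk-high {t} d<t with t ℕ.≤? d
    ... | yes t≤d = ⊥-elim (ℕP.<⇒≱ d<t t≤d)
    ... | no _    = refl

    private
      high-bounds : ∀ {t} → d ℕ.< t → t ℕ.≤ d ℕ.+ d → 1 ℕ.≤ L ∸ t × L ∸ t ℕ.≤ d
      high-bounds {t} d<t t≤2d = ℕP.m<n⇒0<n∸m (s≤s t≤2d) ,
        ℕP.≤-trans (ℕP.∸-monoʳ-≤ L d<t) (ℕP.≤-reflexive (ℕP.m+n∸n≡m d d))

    walk-adj : ∀ t → t ℕ.≤ d ℕ.+ d → Adj G (walk t) (walk (suc t))
    walk-adj t t≤2d with ℕP.<-cmp t d
    ... | tri< st≤d _ _ = subst₂ (Adj G) (sym (walk-low (ℕP.<⇒≤ st≤d))) (sym (walk-low st≤d)) (Adj-sym G (vertex-adj st≤d))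
    ... | tri≈ _ refl _ = subst₂ (Adj G) (sym (trans (walk-low ℕP.≤-refl) vertex-top))
                                         (sym (trans (walk-high ℕP.≤-refl) (trans (cong Q (ℕP.m+n∸n≡m d d)) Q-top))) uv
    ... | tri> _ _ d<t  = subst₂ (Adj G) (sym (trans (walk-high d<t) (cong Q (ℕP.+-∸-assoc 1 t≤2d))))
                                         (sym (walk-high (ℕP.m<n⇒m<1+n d<t)))
                                         (Q-adj (subst (ℕ._≤ d) (ℕP.+-∸-assoc 1 t≤2d) (proj₂ (high-bounds d<t t≤2d))))

    -- A left inverse of the walk in G/V_i: the colour tells the two geodesics apart.
    decode : Maybe (Fin n) → ℕ
    decode nothing  = 0
    decode (just x) = if does (c x Fin.≟ c (P (depth x))) then depth x else L ∸ depth x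

    private
      decode-P : ∀ {s} → s ℕ.≤ d → decode (just (P s)) ≡ s
      decode-P {s} s≤d rewrite vertex-depth s≤d | dec-true (c (P s) Fin.≟ c (P s)) refl = refl

      decode-Q : ∀ {s} → 1 ℕ.≤ s → s ℕ.≤ d → decode (just (Q s)) ≡ L ∸ s
      decode-Q {s} 1≤s s≤d rewrite Q-depth s≤d
        | dec-false (c (Q s) Fin.≟ c (P s)) (geodesics-colour≢ γ δ (proper u v uv) 1≤s s≤d ∘ sym) = refl

    decode-walk : ∀ {t} → t ℕ.≤ d ℕ.+ d → decode (contractMap c i (walk t)) ≡ t
    decode-walk {zero} _ = cong decode (trans (cong (contractMap c i) (walk-low z≤n))
                                              (contractMap-inside c (depth≡0⇒colour (vertex-depth z≤n))))
    decode-walk {suc t} st≤2d with ℕP.≤-<-connex (suc t) d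
    ... | inj₁ st≤d = trans (cong (decode ∘ contractMap c i) (walk-low st≤d))
                           (trans (cong decode (contractMap-outside c (geodesic-colour≢ γ (s≤s z≤n) st≤d))) (decode-P st≤d))
    ... | inj₂ d<st with high-bounds d<st st≤2d
    ...   | 1≤s , s≤d = trans (cong (decode ∘ contractMap c i) (walk-high d<st))
                          (trans (cong decode (contractMap-outside c (geodesic-colour≢ δ 1≤s s≤d)))
                          (trans (decode-Q 1≤s s≤d) (ℕP.m∸[m∸n]≡n (ℕP.m≤n⇒m≤1+n st≤2d))))

    private
      F : ℕ → Maybe (Fin n)
      F t = contractMap c i (walk t)

      F-period : F L ≡ F 0
      F-period = trans (cong (contractMap c i) (trans (walk-high (s≤s (ℕP.m≤m+n d d))) (cong Q (ℕP.n∸n≡0 L))))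
                   (trans (contractMap-inside c (depth≡0⇒colour (Q-depth z≤n)))
                          (sym (contractMap-inside c (depth≡0⇒colour (vertex-depth z≤n)))))

      F-distinct : ∀ t → t ℕ.≤ d ℕ.+ d → F t ≢ F (suc t)
      F-distinct t t≤2d eq with ℕP.m≤n⇒m<n∨m≡n t≤2d
      ... | inj₁ t<2d = ℕP.1+n≢n (trans (sym (decode-walk t<2d)) (trans (cong decode (sym eq)) (decode-walk t≤2d)))
      ... | inj₂ refl = ℕP.1+n≢0 (trans (sym (decode-walk t≤2d)) (trans (cong decode (trans eq F-period)) (decode-walk z≤n)))

      F-adj : ∀ t → t ℕ.≤ d ℕ.+ d → ContractAdj G c i (F t) (F (suc t))
      F-adj t t≤2d = F-distinct t t≤2d , walk t , walk (suc t) , refl , refl , walk-adj t t≤2d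

    cycle : Fin L → Maybe (Fin n)
    cycle p = F (toℕ p)

    cycle-injective : Injective _≡_ _≡_ cycle
    cycle-injective {p} {q} eq = FinP.toℕ-injective
      (trans (sym (decode-walk (ℕP.≤-pred (FinP.toℕ<n p)))) (trans (cong decode eq) (decode-walk (ℕP.≤-pred (FinP.toℕ<n q)))))

    oddCycle : OddCycleOfLength (ContractAdj G c i) L
    oddCycle = e , oddLength e , cycle , cycle-injective , cyclic-fromℕ (ContractAdj G c i) F F-adj F-period

  module Homomorphism (girth : ∀ L → OddCycleOfLength (ContractAdj G c i) L → suc (suc k ℕ.+ suc k) ℕ.≤ L) where

    flatEdge-depth : ∀ {u v} → Adj G u v → depth u ≡ depth v → depth u ≡ suc k
    flatEdge-depth {u} {v} uv du≡dv with depth u in du | ℕP.m≤n⇒m<n∨m≡n (depth-≤ u)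
    ... | _     | inj₂ du≡K = du≡K
    ... | zero  | inj₁ _    = ⊥-elim (proper u v uv (trans (depth≡0⇒colour du) (sym (depth≡0⇒colour (sym du≡dv)))))
    ... | suc e | inj₁ e<k  = ⊥-elim (ℕP.<⇒≱ (ℕP.+-mono-< e<k e<k)
                                (ℕP.≤-pred (girth _ (FlatEdge.oddCycle uv du (sym du≡dv) e<k))))

    σ : Fin n → Bool
    σ v = even (depth v) xor side i (c v)

    -- Layer d ≥ 1 goes to d or to 2(k+1)+1 − d according to σ, which is constant along edges
    -- between layers and differs across edges inside the top layer.
    position : ℕ → Bool → ℕ
    position zero    _     = 0
    position (suc d) true  = suc d
    position (suc d) false = suc (suc k ℕ.+ suc k) ∸ suc d

    pos : Fin n → ℕ
    pos v = position (depth v) (σ v)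

    pos-≤ : ∀ v → pos v ℕ.≤ suc k ℕ.+ suc k
    pos-≤ v = bound (depth v) (σ v) (depth-≤ v)
      where
      bound : ∀ d s → d ℕ.≤ suc k → position d s ℕ.≤ suc k ℕ.+ suc k
      bound zero    _     _   = z≤n
      bound (suc d) true  d≤K = ℕP.≤-trans d≤K (ℕP.m≤m+n (suc k) (suc k))
      bound (suc d) false _   = ℕP.m∸n≤m (suc k ℕ.+ suc k) d

    private
      not-xor-not : ∀ x y → not x xor not y ≡ x xor y
      not-xor-not x y = trans (sym (BoolP.not-distribˡ-xor x (not y)))
                              (trans (cong not (sym (BoolP.not-distribʳ-xor x y))) (BoolP.not-involutive (x xor y)))

      colour≢i : ∀ {v d} → depth v ≡ suc d → c v ≢ i
      colour≢i dv≡ = depth>0⇒colour≢ (ℕP.≤-trans (s≤s z≤n) (ℕP.≤-reflexive (sym dv≡)))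

    σ-descend : ∀ {u v d} → Adj G u v → depth u ≡ suc (suc d) → depth v ≡ suc d → σ u ≡ σ v
    σ-descend {u} {v} {d} uv du dv = begin
      even (depth u) xor side i (c u)                  ≡⟨ cong₂ _xor_ (trans (cong even du) (trans (even-suc (suc d)) (cong (not ∘ even) (sym dv))))
                                                                      (side-flip (colour≢i du) (colour≢i dv) (proper u v uv)) ⟩
      not (even (depth v)) xor not (side i (c v))      ≡⟨ not-xor-not (even (depth v)) (side i (c v)) ⟩
      even (depth v) xor side i (c v)                  ∎
      where open ≡-Reasoning

    σ-flat : ∀ {u v} → Adj G u v → depth u ≡ depth v → depth u ≡ suc k → σ u ≢ σ v
    σ-flat {u} {v} uv du≡dv du σu≡σv = BoolP.not-¬
      (xor-cancelˡ (even (depth u)) (trans σu≡σv (cong (λ d → even d xor side i (c v)) (sym du≡dv))))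
      (side-flip (colour≢i du) (colour≢i (trans (sym du≡dv) du)) (proper u v uv))
      where
      xor-cancelˡ : ∀ x {y z} → x xor y ≡ x xor z → y ≡ z
      xor-cancelˡ false eq = eq
      xor-cancelˡ true  eq = BoolP.not-injective eq

    private
      top : ℕ
      top = suc k ℕ.+ suc k

      position-1 : ∀ s → CycleAdj top (position 1 s) 0
      position-1 true  = inj₂ step
      position-1 false = inj₁ wrap

      position-descend : ∀ d s → suc (suc d) ℕ.≤ suc k → CycleAdj top (position (suc (suc d)) s) (position (suc d) s)
      position-descend d true  _     = inj₂ step
      position-descend d false ssd≤K =
        inj₁ (subst (CycleEdge top _) (sym (ℕP.+-∸-assoc 1 (ℕP.≤-trans ssd≤K (ℕP.m≤n⇒m≤1+n (ℕP.m≤m+n (suc k) (suc k)))))) step)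

      position-top : ∀ s s′ → s ≢ s′ → CycleAdj top (position (suc k) s) (position (suc k) s′)
      position-top true  false _ = inj₁ (subst (CycleEdge top (suc k)) (sym (ℕP.m+n∸n≡m (suc (suc k)) (suc k))) step)
      position-top false true  _ = inj₂ (subst (CycleEdge top (suc k)) (sym (ℕP.m+n∸n≡m (suc (suc k)) (suc k))) step)
      position-top true  true  s≢s′ = ⊥-elim (s≢s′ refl)
      position-top false false s≢s′ = ⊥-elim (s≢s′ refl)

    hom-descend : ∀ {u v} → Adj G u v → depth u ≡ suc (depth v) → CycleAdj top (pos u) (pos v)
    hom-descend {u} {v} uv du = descend (depth v) refl
      where
      atDepths : ∀ {a b} → depth u ≡ a → depth v ≡ b →
                 CycleAdj top (position a (σ u)) (position b (σ v)) → CycleAdj top (pos u) (pos v)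
      atDepths du≡ dv≡ = subst₂ (λ a b → CycleAdj top (position a (σ u)) (position b (σ v))) (sym du≡) (sym dv≡)
      descend : ∀ d → depth v ≡ d → CycleAdj top (pos u) (pos v)
      descend zero    dv≡ = atDepths (trans du (cong suc dv≡)) dv≡ (position-1 (σ u))
      descend (suc d) dv≡ = atDepths du′ dv≡
        (subst (λ s → CycleAdj top (position (suc (suc d)) s) (position (suc d) (σ v))) (sym (σ-descend uv du′ dv≡))
               (position-descend d (σ v) (subst (ℕ._≤ suc k) du′ (depth-≤ u))))
        where
        du′ : depth u ≡ suc (suc d)
        du′ = trans du (cong suc dv≡)

    hom-flat : ∀ {u v} → Adj G u v → depth u ≡ depth v → CycleAdj top (pos u) (pos v)
    hom-flat {u} {v} uv du≡dv =
      subst₂ (λ a b → CycleAdj top (position a (σ u)) (position b (σ v))) K≡du (trans K≡du du≡dv)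
             (position-top (σ u) (σ v) (σ-flat uv du≡dv (sym K≡du)))
      where
      K≡du : suc k ≡ depth u
      K≡du = sym (flatEdge-depth uv du≡dv)

    hom : ∀ {u v} → Adj G u v → CycleAdj top (pos u) (pos v)
    hom {u} {v} uv with ℕP.<-cmp (depth u) (depth v)
    ... | tri< du<dv _ _ = Sum.swap (hom-descend (Adj-sym G uv) (ℕP.≤-antisym (depth-adj (Adj-sym G uv)) du<dv))
    ... | tri≈ _ du≡dv _ = hom-flat uv du≡dv
    ... | tri> _ _ dv<du = hom-descend uv (ℕP.≤-antisym (depth-adj uv) dv<du)

2*suc∸1 : ∀ K → 2 * suc K ∸ 1 ≡ suc (K ℕ.+ K)
2*suc∸1 K = trans (ℕP.+-suc K (K ℕ.+ 0)) (cong (λ x → ℕ.suc (K ℕ.+ x)) (ℕP.+-identityʳ K))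

upperBound-colourClass : ∀ {n} (G : Graph n) (c : Fin n → Fin 3) → ProperColoring G 3 c →
  ∀ i ρ → IsOddGirth (ContractAdj G c i) (2 * ρ ∸ 1) →
  ∀ r → IsFractionalChromaticNumber G r → r ≤ (+ 2 / 1) + invPred ρ
upperBound-colourClass G c proper i zero             ((_ , () , _) , _)
upperBound-colourClass G c proper i (suc zero)       ((_ , () , _) , _)
upperBound-colourClass G c proper i (suc (suc k)) (_ , shortest) =
  cycleHomomorphism-fractional G pos pos-≤ hom
  where
  open Layers G c proper i k
  open Homomorphism (λ L cycle → subst (ℕ._≤ L) (2*suc∸1 (suc k)) (shortest L cycle))

uncontract : ∀ {n} → Fin n → Maybe (Fin n) → Fin n
uncontract v₀ nothing  = v₀
uncontract v₀ (just w) = w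

module _ {n} (G : Graph n) (c : Fin n → Fin 3) (i : Fin 3) {v₀} (singleton : ∀ w → c w ≡ i → w ≡ v₀) where

  uncontract-contractMap : ∀ u → uncontract v₀ (contractMap c i u) ≡ u
  uncontract-contractMap u with c u Fin.≟ i
  ... | yes cu≡i = sym (singleton u cu≡i)
  ... | no _     = refl

  contractAdj-lift : ∀ {a b} → ContractAdj G c i a b → Adj G (uncontract v₀ a) (uncontract v₀ b)
  contractAdj-lift (_ , u , v , u↦a , v↦b , uv) =
    subst₂ (Adj G) (trans (sym (uncontract-contractMap u)) (cong (uncontract v₀) u↦a))
                   (trans (sym (uncontract-contractMap v)) (cong (uncontract v₀) v↦b)) uv

  lowerBound-singletonClass : ∀ ρ → IsOddGirth (ContractAdj G c i) (2 * ρ ∸ 1) →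
    ∀ y → Feasible G y → (+ 2 / 1) + invPred ρ ≤ objective G y
  lowerBound-singletonClass zero          ((_ , () , _) , _)
  lowerBound-singletonClass (suc zero)    ((_ , () , _) , _)
  lowerBound-singletonClass (suc (suc k)) ((_ , _ , _ , _ , adjacent) , _) y feasible =
    fractional-oddWalk G (ℕP.suc-injective (2*suc∸1 (suc k))) feasible (contractAdj-lift ∘ adjacent)

⊓₃-≤ : ∀ (f : Fin 3 → ℚ) i → f zero ⊓ f (suc zero) ⊓ f (suc (suc zero)) ≤ f i
⊓₃-≤ f zero             = ℚP.≤-trans (ℚP.p⊓q≤p _ (f (suc (suc zero)))) (ℚP.p⊓q≤p (f zero) (f (suc zero)))
⊓₃-≤ f (suc zero)       = ℚP.≤-trans (ℚP.p⊓q≤p _ (f (suc (suc zero)))) (ℚP.p⊓q≤q (f zero) (f (suc zero)))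
⊓₃-≤ f (suc (suc zero)) = ℚP.p⊓q≤q (f zero ⊓ f (suc zero)) _

+⊓₃-glb : ∀ x r (f : Fin 3 → ℚ) → (∀ i → r ≤ x + f i) → r ≤ x + (f zero ⊓ f (suc zero) ⊓ f (suc (suc zero)))
+⊓₃-glb x r f bound = ℚP.≤-trans (ℚP.⊓-glb (ℚP.⊓-glb (bound zero) (bound (suc zero))) (bound (suc (suc zero))))
  (ℚP.≤-reflexive (sym (trans (shift (f zero ⊓ f (suc zero)) (f (suc (suc zero))))
                              (cong (_⊓ (x + f (suc (suc zero)))) (shift (f zero) (f (suc zero)))))))
  where
  shift : ∀ p q → x + (p ⊓ q) ≡ (x + p) ⊓ (x + q)
  shift = ℚP.mono-≤-distrib-⊓ (ℚP.+-monoʳ-≤ x)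

mainTheorem17 : ∀ {n} (G : Graph n) (c : Fin n → Fin 3) →
    ChromaticNumber G 3 → ProperColoring G 3 c →
    (ρ : Fin 3 → ℕ) →
    (∀ i → IsOddGirth (ContractAdj G c i) (2 * ρ i ∸ 1)) →
    (r : ℚ) → IsFractionalChromaticNumber G r →
    (r ≤ (+ 2 / 1) + (invPred (ρ zero) ⊓ invPred (ρ (suc zero)) ⊓ invPred (ρ (suc (suc zero)))))
    × ((Σ (Fin 3) λ i → Σ (Fin n) λ v → (c v ≡ i) × (∀ w → c w ≡ i → w ≡ v)) →
       r ≡ (+ 2 / 1) + (invPred (ρ zero) ⊓ invPred (ρ (suc zero)) ⊓ invPred (ρ (suc (suc zero)))))
mainTheorem17 {n} G c _ proper ρ oddGirth r isFractional@((y , feasible , objective≡r) , _) = upper , tight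
  where
  μ : ℚ
  μ = invPred (ρ zero) ⊓ invPred (ρ (suc zero)) ⊓ invPred (ρ (suc (suc zero)))
  upper : r ≤ (+ 2 / 1) + μ
  upper = +⊓₃-glb (+ 2 / 1) r (invPred ∘ ρ)
            (λ i → upperBound-colourClass G c proper i (ρ i) (oddGirth i) r isFractional)
  tight : (Σ (Fin 3) λ i → Σ (Fin n) λ v → (c v ≡ i) × (∀ w → c w ≡ i → w ≡ v)) → r ≡ (+ 2 / 1) + μ
  tight (i , v₀ , _ , singleton) = ℚP.≤-antisym upper (begin
    (+ 2 / 1) + μ              ≤⟨ ℚP.+-monoʳ-≤ (+ 2 / 1) (⊓₃-≤ (invPred ∘ ρ) i) ⟩
    (+ 2 / 1) + invPred (ρ i)  ≤⟨ lowerBound-singletonClass G c i singleton (ρ i) (oddGirth i) y feasible ⟩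
    objective G y              ≡⟨ objective≡r ⟩
    r                          ∎)
    where open ℚP.≤-Reasoning
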